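{- Let $G$ be a finite $2$-transitive permutation group with a regular normal subgroup $N$. Then $G$ is a Frobenius group if and only if the derangement graph $\Gamma_G$ is a disjoint union of complete graphs.
   Context: $\Gamma_G$ is the Cayley graph on $G$ whose connection set is the set of fixed-point-free elements of $G$. -}

module Defs where

open import Data.Nat using (ℕ)
open import Data.Fin using (Fin)
open import Data.List using (List)
open import Data.List.Relation.Unary.Any using (Any)
open import Data.Product using (Σ; _×_; ∃)
open import Relation.Binary.PropositionalEquality using (_≡_; _≗_)
open import Relation.Nullary using (¬_)
open import Function using (_∘_; id)

Map : ℕ → Set
Map n = Fin n → Fin n

-- A finite permutation group of degree n: a finite list of maps
-- Fin n → Fin n; membership is up to pointwise equality; closed under
-- identity, composition and inverses (so every element is a bijection).
record PermGroup (n : ℕ) : Set where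
  field
    elems : List (Map n)

  _∈G : Map n → Set
  f ∈G = Any (λ g → f ≗ g) elems

  field
    id∈   : id ∈G
    comp∈ : ∀ f g → f ∈G → g ∈G → (f ∘ g) ∈G
    inv∈  : ∀ f → f ∈G → Σ (Map n) λ g → g ∈G × (f ∘ g ≗ id) × (g ∘ f ≗ id)

open PermGroup public

_≤G_ : ∀ {n} → PermGroup n → PermGroup n → Set
_≤G_ {n} H G = ∀ (f : Map n) → (H ∈G) f → (G ∈G) f

Normal : ∀ {n} → PermGroup n → PermGroup n → Set
Normal {n} H G =
  H ≤G G ×
  (∀ (g h m : Map n) → (G ∈G) g → (G ∈G) h → (g ∘ h ≗ id) → (h ∘ g ≗ id) →
     (H ∈G) m → (H ∈G) (g ∘ m ∘ h))

Transitive : ∀ {n} → PermGroup n → Set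
Transitive {n} G = ∀ (x y : Fin n) → Σ (Map n) λ g → (G ∈G) g × g x ≡ y

TwoTransitive : ∀ {n} → PermGroup n → Set
TwoTransitive {n} G =
  ∀ (a b c d : Fin n) → ¬ a ≡ b → ¬ c ≡ d →
    Σ (Map n) λ g → (G ∈G) g × g a ≡ c × g b ≡ d

Semiregular : ∀ {n} → PermGroup n → Set
Semiregular {n} G = ∀ (g : Map n) → (G ∈G) g → ∀ x → g x ≡ x → g ≗ id

Regular : ∀ {n} → PermGroup n → Set
Regular G = Transitive G × Semiregular G

Frobenius : ∀ {n} → PermGroup n → Set
Frobenius {n} G =
  Transitive G × ¬ Regular G ×
  (∀ (g : Map n) → (G ∈G) g → ¬ (g ≗ id) →
     ∀ x y → g x ≡ x → g y ≡ y → x ≡ y)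

Derangement : ∀ {n} → Map n → Set
Derangement {n} s = ∀ (x : Fin n) → ¬ s x ≡ x

CayleyAdj : ∀ {n} → (G : PermGroup n) → (Map n → Set) → Map n → Map n → Set
CayleyAdj {n} G S g h = Σ (Map n) λ s → (G ∈G) s × S s × (h ≗ g ∘ s)

DerangementAdj : ∀ {n} → PermGroup n → Map n → Map n → Set
DerangementAdj G = CayleyAdj G Derangement

-- A graph on the vertex set of G (elements of G, up to ≗) with adjacency
-- Adj is a disjoint union of complete graphs: there is a partition of the
-- vertices into blocks (given by a labelling c) such that two vertices are
-- adjacent iff they are distinct and lie in the same block.
DisjointUnionOfCompleteGraphs : ∀ {n} → PermGroup n → (Map n → Map n → Set) → Set
DisjointUnionOfCompleteGraphs {n} G Adj =
  Σ (Map n → ℕ) λ c →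
    ∀ (u v : Map n) → (G ∈G) u → (G ∈G) v →
      (Adj u v → ¬ (u ≗ v) × c u ≡ c v) ×
      (¬ (u ≗ v) × c u ≡ c v → Adj u v)

module Submission where

-- The proof only uses that N ≤ G is regular, and rests on one
-- counting device.  For g ∈ G and a point z there is exactly one element of the
-- coset gN fixing z, namely g ∘ fixer z, where fixer z ∈ N maps z to g⁻¹ z.
-- Recording fixer z by its value at a base point b gives an endomap
-- z ↦ fixer z b of the point set, and g ∘ m (m ∈ N) is a derangement exactly
-- when m b is missed by this map.  The pigeonhole principle for Fin n then
-- gives both directions:
--   * if every non-identity element fixes at most one point, the map is
--     injective unless g ∈ N, so every derangement of G lies in N; hence the
--     derangement graph joins exactly the distinct elements of a left coset of
--     N, i.e. it is a disjoint union of complete graphs (one per coset);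
--   * if g ∈ G fixes two points x ≠ y, the map (with b = x) is not injective,
--     so some m ∈ N ∖ {1} makes g ∘ m a derangement; then 1 ~ g ∘ m ~ g in the
--     derangement graph, and if that graph is a union of cliques, 1 ~ g, so g
--     is a derangement, which is absurd.

open import Defs
open import Data.Nat using (ℕ; zero; suc; _≤_; s≤s)
open import Data.Nat.Properties using (n<1+n; suc-injective)
open import Data.Fin using (Fin; zero; suc; punchOut; _≟_; _<_)
open import Data.Fin.Properties using (any?; all?; ¬∀⟶∃¬; pigeonhole; punchOut-injective; <⇒≢)
open import Data.List using (List; []; _∷_)
open import Data.List.Relation.Unary.Any as Any using (Any; here; there)
open import Data.List.Membership.Propositional using (find)
open import Data.Product using (Σ; _×_; _,_; proj₁; proj₂; ∃; ∃₂)
open import Data.Empty using (⊥-elim)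
open import Relation.Nullary using (¬_; Dec; yes; no)
open import Relation.Nullary.Decidable using (map′)
open import Relation.Unary using (Pred; Decidable)
open import Relation.Binary.PropositionalEquality
open import Function using (_∘_; id)
open import Function.Bundles using (_⇔_; mk⇔)

injective⇒surjective : ∀ {n} (f : Fin n → Fin n) →
  (∀ {x y} → f x ≡ f y → x ≡ y) → ∀ w → ∃ λ z → f z ≡ w
injective⇒surjective {suc k} f inj w with any? (λ z → f z ≟ w)
... | yes hit = hit
... | no miss = ⊥-elim (noCollision (pigeonhole (n<1+n k) (λ z → punchOut (avoids z))))
  where
  -- Without w in the image, f factors through Fin k, which is too small.
  avoids : ∀ z → w ≢ f z
  avoids z w≡fz = miss (z , sym w≡fz)

  noCollision : ¬ (∃₂ λ i j → i < j × punchOut (avoids i) ≡ punchOut (avoids j))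
  noCollision (i , j , i<j , eq) = <⇒≢ i<j (inj (punchOut-injective (avoids i) (avoids j) eq))

-- Dually, an endomap of a finite set identifying two distinct points misses a
-- point: otherwise a section of it would be injective, hence surjective.
collision⇒miss : ∀ {n} (f : Fin n → Fin n) {x y} → x ≢ y → f x ≡ f y →
  ∃ λ w → ∀ z → f z ≢ w
collision⇒miss {n} f {x} {y} x≢y fx≡fy with all? (λ w → any? (λ z → f z ≟ w))
... | no notOnto
  with w , missed ← ¬∀⟶∃¬ n _ (λ w → any? (λ z → f z ≟ w)) notOnto
  = w , λ z fz≡w → missed (z , fz≡w)
... | yes onto = ⊥-elim (x≢y x≡y)
  where
  section : Fin n → Fin n
  section w = proj₁ (onto w)

  f∘section : ∀ w → f (section w) ≡ w
  f∘section w = proj₂ (onto w)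

  section-injective : ∀ {a b} → section a ≡ section b → a ≡ b
  section-injective {a} {b} eq =
    trans (sym (f∘section a)) (trans (cong f eq) (f∘section b))

  x≡y : x ≡ y
  x≡y with a , sa≡x ← injective⇒surjective section section-injective x
         | b , sb≡y ← injective⇒surjective section section-injective y
    = begin
      x                  ≡⟨ sym sa≡x ⟩
      section a          ≡⟨ cong section a≡b ⟩
      section b          ≡⟨ sb≡y ⟩
      y                  ∎
    where
    open ≡-Reasoning
    a≡b : a ≡ b
    a≡b = begin
      a                  ≡⟨ sym (f∘section a) ⟩
      f (section a)      ≡⟨ cong f sa≡x ⟩
      f x                ≡⟨ fx≡fy ⟩
      f y                ≡⟨ cong f (sym sb≡y) ⟩
      f (section b)      ≡⟨ f∘section b ⟩
      b                  ∎

firstIndex : ∀ {a p} {A : Set a} {P : Pred A p} → Decidable P → List A → ℕ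
firstIndex P? [] = 0
firstIndex P? (x ∷ xs) with P? x
... | yes _ = 0
... | no _ = suc (firstIndex P? xs)

module _ {a p q} {A : Set a} {P : Pred A p} {Q : Pred A q}
         (P? : Decidable P) (Q? : Decidable Q) where

  firstIndex-cong : (∀ {x} → P x → Q x) → (∀ {x} → Q x → P x) →
    ∀ xs → firstIndex P? xs ≡ firstIndex Q? xs
  firstIndex-cong P⇒Q Q⇒P [] = refl
  firstIndex-cong P⇒Q Q⇒P (x ∷ xs) with P? x | Q? x
  ... | yes _  | yes _  = refl
  ... | yes px | no ¬qx = ⊥-elim (¬qx (P⇒Q px))
  ... | no ¬px | yes qx = ⊥-elim (¬px (Q⇒P qx))
  ... | no _   | no _   = cong suc (firstIndex-cong P⇒Q Q⇒P xs)

  firstIndex-common : ∀ {xs} → Any P xs → firstIndex P? xs ≡ firstIndex Q? xs →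
    ∃ λ x → P x × Q x
  firstIndex-common {x ∷ xs} anyP eq with P? x | Q? x
  ... | yes px | yes qx = x , px , qx
  firstIndex-common {x ∷ xs} anyP () | yes _ | no _
  firstIndex-common {x ∷ xs} anyP () | no _ | yes _
  firstIndex-common {x ∷ xs} (here px) eq | no ¬px | no _ = ⊥-elim (¬px px)
  firstIndex-common {x ∷ xs} (there anyP) eq | no _ | no _ =
    firstIndex-common anyP (suc-injective eq)

module _ {n : ℕ} where

  _≗?_ : (f g : Map n) → Dec (f ≗ g)
  f ≗? g = all? (λ x → f x ≟ g x)

  ∈-resp-≗ : (H : PermGroup n) {f f' : Map n} → f' ≗ f → (H ∈G) f → (H ∈G) f'
  ∈-resp-≗ H f'≗f = Any.map (λ f≗g x → trans (f'≗f x) (f≗g x))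

  member : (H : PermGroup n) {P : Map n → Set} → Any P (elems H) →
    Σ (Map n) λ m → (H ∈G) m × P m
  member H anyP with m , m∈elems , pm ← find anyP =
    m , Any.map (λ { refl _ → refl }) m∈elems , pm

  element-injective : (H : PermGroup n) {u : Map n} → (H ∈G) u →
    ∀ {a b} → u a ≡ u b → a ≡ b
  element-injective H u∈H {a} {b} eq
    with ui , _ , _ , ui∘u≗id ← inv∈ H _ u∈H =
    trans (sym (ui∘u≗id a)) (trans (cong ui eq) (ui∘u≗id b))

  leftInverse∈ : (H : PermGroup n) {d f : Map n} → (H ∈G) f → d ∘ f ≗ id → (H ∈G) d
  leftInverse∈ H {d} f∈H d∘f≗id with fi , fi∈H , f∘fi≗id , _ ← inv∈ H _ f∈H =
    ∈-resp-≗ H (λ x → trans (cong d (sym (f∘fi≗id x))) (d∘f≗id (fi x))) fi∈H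

  transitive-≤ : (H G : PermGroup n) → H ≤G G → Transitive H → Transitive G
  transitive-≤ H G H≤G transH x y with g , g∈H , gx≡y ← transH x y = g , H≤G g g∈H , gx≡y

  semiregular-unique : (H : PermGroup n) → Semiregular H →
    ∀ {m m'} → (H ∈G) m → (H ∈G) m' → ∀ {p} → m p ≡ m' p → m ≗ m'
  semiregular-unique H semi {m} {m'} m∈H m'∈H {p} mp≡m'p z
    with mi , mi∈H , m'∘mi≗id , mi∘m'≗id ← inv∈ H m' m'∈H =
    trans (sym (m'∘mi≗id (m z)))
          (cong m' (semi (mi ∘ m) (comp∈ H mi m mi∈H m∈H) p
                         (trans (cong mi mp≡m'p) (mi∘m'≗id p)) z))

  semiregular-derangement : (H : PermGroup n) → Semiregular H →
    ∀ {m} → (H ∈G) m → ¬ (m ≗ id) → Derangement m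
  semiregular-derangement H semi {m} m∈H m≠id z mz≡z = m≠id (semi m m∈H z mz≡z)

  -- The third clause of the definition of a Frobenius group.
  FixesAtMostOnePoint : PermGroup n → Set
  FixesAtMostOnePoint G = ∀ (g : Map n) → (G ∈G) g → ¬ (g ≗ id) →
    ∀ x y → g x ≡ x → g y ≡ y → x ≡ y

-- A 2-transitive group of degree at least 3 is not semiregular: some element
-- fixes one point and moves another.
twoTransitive⇒¬semiregular : ∀ {k} (G : PermGroup (suc (suc (suc k)))) →
  TwoTransitive G → ¬ Semiregular G
twoTransitive⇒¬semiregular G twoTrans semi
  with g , g∈G , g0≡0 , g1≡2 ← twoTrans zero (suc zero) zero (suc (suc zero)) (λ ()) (λ ())
  with () ← trans (sym (semi g g∈G zero g0≡0 (suc zero))) g1≡2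

module _ {n : ℕ} (N : PermGroup n) where

  data SameCoset (u v : Map n) : Set where
    inCoset : ∀ {m} → (N ∈G) m → v ≗ u ∘ m → SameCoset u v

  sameCoset? : ∀ u → Decidable (SameCoset u)
  sameCoset? u v = map′ fromAny toAny (Any.any? (λ m → v ≗? (u ∘ m)) (elems N))
    where
    fromAny : Any (λ m → v ≗ u ∘ m) (elems N) → SameCoset u v
    fromAny found with m , m∈N , v≗um ← member N found = inCoset m∈N v≗um

    toAny : SameCoset u v → Any (λ m → v ≗ u ∘ m) (elems N)
    toAny (inCoset m∈N v≗um) = Any.map (λ m≗k z → trans (v≗um z) (cong u (m≗k z))) m∈N

  sameCoset-reflexive : ∀ {u v} → u ≗ v → SameCoset u v
  sameCoset-reflexive u≗v = inCoset (id∈ N) (λ z → sym (u≗v z))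

  sameCoset-euclidean : ∀ {u v w} → SameCoset u v → SameCoset u w → SameCoset v w
  sameCoset-euclidean {u} {v} {w} (inCoset {m₀} m₀∈N v≗um₀) (inCoset {m} m∈N w≗um)
    with m₀i , m₀i∈N , m₀∘m₀i≗id , _ ← inv∈ N m₀ m₀∈N =
    inCoset (comp∈ N m₀i m m₀i∈N m∈N) λ z → begin
      w z                  ≡⟨ w≗um z ⟩
      u (m z)              ≡⟨ cong u (sym (m₀∘m₀i≗id (m z))) ⟩
      u (m₀ (m₀i (m z)))   ≡⟨ sym (v≗um₀ (m₀i (m z))) ⟩
      v (m₀i (m z))        ∎
    where open ≡-Reasoning

  sameCoset-sym : ∀ {u v} → SameCoset u v → SameCoset v u
  sameCoset-sym uv = sameCoset-euclidean uv (sameCoset-reflexive (λ _ → refl))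

  sameCoset-trans : ∀ {u v w} → SameCoset u v → SameCoset v w → SameCoset u w
  sameCoset-trans uv vw = sameCoset-euclidean (sameCoset-sym uv) vw

  -- Label an element by the position in the list of G of the first element
  -- of its left coset; elements of G get equal labels iff they share a coset.
  cosetLabel : PermGroup n → Map n → ℕ
  cosetLabel G u = firstIndex (sameCoset? u) (elems G)

  sameCoset⇒sameLabel : ∀ G {u v} → SameCoset u v → cosetLabel G u ≡ cosetLabel G v
  sameCoset⇒sameLabel G uv =
    firstIndex-cong (sameCoset? _) (sameCoset? _)
      (sameCoset-euclidean uv) (sameCoset-trans uv) (elems G)

  sameLabel⇒sameCoset : ∀ G {u v} → (G ∈G) u → cosetLabel G u ≡ cosetLabel G v → SameCoset u v
  sameLabel⇒sameCoset G u∈G eq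
    with w , uw , vw ← firstIndex-common (sameCoset? _) (sameCoset? _)
                         (Any.map sameCoset-reflexive u∈G) eq =
    sameCoset-trans uw (sameCoset-sym vw)

module _ {n : ℕ} (G : PermGroup n) where

  cliques-trans : {Adj : Map n → Map n → Set} → DisjointUnionOfCompleteGraphs G Adj →
    ∀ {u v w} → (G ∈G) u → (G ∈G) v → (G ∈G) w →
    Adj u v → Adj v w → ¬ (u ≗ w) → Adj u w
  cliques-trans (_ , cliques) u∈G v∈G w∈G uv vw u≠w =
    proj₂ (cliques _ _ u∈G w∈G)
      (u≠w , trans (proj₂ (proj₁ (cliques _ _ u∈G v∈G) uv))
                   (proj₂ (proj₁ (cliques _ _ v∈G w∈G) vw)))

  derangementAdj-irreflexive : Fin n → ∀ {u v} → (G ∈G) u →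
    DerangementAdj G u v → ¬ (u ≗ v)
  derangementAdj-irreflexive b u∈G (s , _ , s-der , v≗us) u≗v =
    s-der b (element-injective G u∈G (trans (sym (v≗us b)) (sym (u≗v b))))

module RegularSubgroup {n : ℕ} (G N : PermGroup n) (N≤G : N ≤G G) (regN : Regular N) where

  semiregularN : Semiregular N
  semiregularN = proj₂ regN

  carry : Fin n → Fin n → Map n
  carry a b = proj₁ (proj₁ regN a b)

  carry∈N : ∀ a b → (N ∈G) (carry a b)
  carry∈N a b = proj₁ (proj₂ (proj₁ regN a b))

  carry-maps : ∀ a b → carry a b a ≡ b
  carry-maps a b = proj₂ (proj₂ (proj₁ regN a b))

  -- For g ∈ G, the element g ∘ fixer z is the unique element of g N fixing z,
  -- and fixerLabel b z = fixer z b records which one it is.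
  module CosetFixers {g : Map n} (g∈G : (G ∈G) g) where

    gi : Map n
    gi = proj₁ (inv∈ G g g∈G)

    g∘gi≗id : g ∘ gi ≗ id
    g∘gi≗id = proj₁ (proj₂ (proj₂ (inv∈ G g g∈G)))

    gi∘g≗id : gi ∘ g ≗ id
    gi∘g≗id = proj₂ (proj₂ (proj₂ (inv∈ G g g∈G)))

    fixer : Fin n → Map n
    fixer z = carry z (gi z)

    fixer-fixes : ∀ z → g (fixer z z) ≡ z
    fixer-fixes z = trans (cong g (carry-maps z (gi z))) (g∘gi≗id z)

    fixerLabel : Fin n → Fin n → Fin n
    fixerLabel b z = fixer z b

    fixer-unique : ∀ {b x y} → fixerLabel b x ≡ fixerLabel b y → fixer x ≗ fixer y
    fixer-unique = semiregular-unique N semiregularN (carry∈N _ _) (carry∈N _ _)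

    fixes⇒label : ∀ {m} → (N ∈G) m → ∀ {z} → g (m z) ≡ z → ∀ b → m b ≡ fixerLabel b z
    fixes⇒label {m} m∈N {z} gmz≡z b =
      semiregular-unique N semiregularN m∈N (carry∈N _ _)
        (trans (trans (sym (gi∘g≗id (m z))) (cong gi gmz≡z)) (sym (carry-maps z (gi z)))) b

    -- If the label of z is the base point, the fixer is trivial and g fixes z.
    label-base⇒fixed : ∀ {b z} → fixerLabel b z ≡ b → g z ≡ z
    label-base⇒fixed {b} {z} label≡b = begin
      g z                ≡⟨ cong g (sym (fixer≗id z)) ⟩
      g (fixer z z)      ≡⟨ fixer-fixes z ⟩
      z                  ∎
      where
      open ≡-Reasoning
      fixer≗id : fixer z ≗ id
      fixer≗id = semiregularN (fixer z) (carry∈N _ _) b label≡b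

  -- In a group in which non-identity elements fix at most one point, every
  -- derangement d lies in N: otherwise no d ∘ m (m ∈ N) is the identity, so
  -- the fixer labelling is injective, hence onto, and d itself (whose label is
  -- the base point b) has a fixed point.
  derangement∈N : Fin n → FixesAtMostOnePoint G → ∀ {d} → (G ∈G) d → Derangement d → (N ∈G) d
  derangement∈N b frob {d} d∈G d-der =
    leftInverse∈ N (carry∈N _ _) (proj₂ inverted)
    where
    open CosetFixers d∈G

    inverted : ∃ λ z → d ∘ fixer z ≗ id
    inverted with any? (λ z → (d ∘ fixer z) ≗? id)
    ... | yes found = found
    ... | no none = ⊥-elim (d-der (proj₁ hit) (label-base⇒fixed (proj₂ hit)))
      where
      label-injective : ∀ {x y} → fixerLabel b x ≡ fixerLabel b y → x ≡ y
      label-injective {x} {y} eq =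
        frob (d ∘ fixer x) (comp∈ G d (fixer x) d∈G (N≤G _ (carry∈N _ _)))
             (λ d∘fixer≗id → none (x , d∘fixer≗id)) x y (fixer-fixes x)
             (trans (cong d (fixer-unique eq y)) (fixer-fixes y))

      hit : ∃ λ z → fixerLabel b z ≡ b
      hit = injective⇒surjective (fixerLabel b) label-injective b

  -- If g ∈ G fixes two distinct points x, y, then the labelling with base x
  -- identifies x and y, so it misses some w; the element m of N mapping x to
  -- w is not the identity and g ∘ m is a derangement.
  twoFixedPoints⇒derangement : ∀ {g} → (G ∈G) g → ∀ {x y} → x ≢ y → g x ≡ x → g y ≡ y →
    Σ (Map n) λ m → (N ∈G) m × ¬ (m ≗ id) × Derangement (g ∘ m)
  twoFixedPoints⇒derangement g∈G {x} {y} x≢y gx≡x gy≡y =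
    carry x w , carry∈N x w ,
    (λ m≗id → missed x (trans (sym x≡label-x) (trans (sym (m≗id x)) (carry-maps x w)))) ,
    (λ z gmz≡z → missed z (trans (sym (fixes⇒label (carry∈N x w) gmz≡z x)) (carry-maps x w)))
    where
    open CosetFixers g∈G
    x≡label-x : x ≡ fixerLabel x x
    x≡label-x = fixes⇒label (id∈ N) gx≡x x
    x≡label-y : x ≡ fixerLabel x y
    x≡label-y = fixes⇒label (id∈ N) gy≡y x

    miss : ∃ λ w → ∀ z → fixerLabel x z ≢ w
    miss = collision⇒miss (fixerLabel x) x≢y (trans (sym x≡label-x) x≡label-y)
    w : Fin n
    w = proj₁ miss
    missed : ∀ z → fixerLabel x z ≢ w
    missed = proj₂ miss

  -- Hence such a g is joined to the identity by a path 1 ~ g ∘ m ~ g of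
  -- length two in the derangement graph, where m⁻¹ ∈ N is a derangement too.
  twoFixedPoints⇒path : ∀ {g} → (G ∈G) g → ∀ {x y} → x ≢ y → g x ≡ x → g y ≡ y →
    Σ (Map n) λ h → (G ∈G) h × DerangementAdj G id h × DerangementAdj G h g
  twoFixedPoints⇒path {g} g∈G x≢y gx≡x gy≡y
    with m , m∈N , m≠id , gm-der ← twoFixedPoints⇒derangement g∈G x≢y gx≡x gy≡y
    with mi , mi∈N , m∘mi≗id , _ ← inv∈ N m m∈N =
    g ∘ m , gm∈G , (g ∘ m , gm∈G , gm-der , λ _ → refl) ,
    (mi , N≤G mi mi∈N ,
     semiregular-derangement N semiregularN mi∈N
       (λ mi≗id → m≠id (λ z → trans (cong m (sym (mi≗id z))) (m∘mi≗id z))) ,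
     λ z → sym (cong g (m∘mi≗id z)))
    where
    gm∈G : (G ∈G) (g ∘ m)
    gm∈G = comp∈ G g m g∈G (N≤G m m∈N)

  -- Forward direction: when non-identity elements fix at most one point,
  -- the derangements of G are the non-identity elements of N, so the
  -- derangement graph is the disjoint union of the cliques on the left cosets.
  fixesAtMostOnePoint⇒cliques : Fin n → FixesAtMostOnePoint G →
    DisjointUnionOfCompleteGraphs G (DerangementAdj G)
  fixesAtMostOnePoint⇒cliques b frob = cosetLabel N G , λ u v u∈G v∈G →
    adjacent⇒sameClique u∈G , sameClique⇒adjacent u∈G
    where
    adjacent⇒sameClique : ∀ {u v} → (G ∈G) u → DerangementAdj G u v →
      ¬ (u ≗ v) × cosetLabel N G u ≡ cosetLabel N G v
    adjacent⇒sameClique u∈G adj@(s , s∈G , s-der , v≗us) =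
      derangementAdj-irreflexive G b u∈G adj ,
      sameCoset⇒sameLabel N G (inCoset (derangement∈N b frob s∈G s-der) v≗us)

    sameClique⇒adjacent : ∀ {u v} → (G ∈G) u →
      ¬ (u ≗ v) × cosetLabel N G u ≡ cosetLabel N G v → DerangementAdj G u v
    sameClique⇒adjacent {u} u∈G (u≠v , sameLabel)
      with inCoset {m} m∈N v≗um ← sameLabel⇒sameCoset N G u∈G sameLabel =
      m , N≤G m m∈N ,
      semiregular-derangement N semiregularN m∈N
        (λ m≗id → u≠v (λ z → trans (cong u (sym (m≗id z))) (sym (v≗um z)))) ,
      v≗um

  -- Backward direction: if g ≠ 1 fixed two points, then 1 ~ g ∘ m ~ g in the
  -- derangement graph, so in a union of cliques 1 ~ g and g is a derangement.
  cliques⇒fixesAtMostOnePoint : DisjointUnionOfCompleteGraphs G (DerangementAdj G) →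
    FixesAtMostOnePoint G
  cliques⇒fixesAtMostOnePoint cliques g g∈G g≠id x y gx≡x gy≡y with x ≟ y
  ... | yes x≡y = x≡y
  ... | no x≢y
    with h , h∈G , id~h , h~g ← twoFixedPoints⇒path g∈G x≢y gx≡x gy≡y
    with s , _ , s-der , g≗s ← cliques-trans G cliques (id∈ G) h∈G g∈G id~h h~g
                                  (λ id≗g → g≠id (λ z → sym (id≗g z)))
    = ⊥-elim (s-der x (trans (sym (g≗s x)) gx≡x))

-- Corollary 5.7: the Frobenius property is the third clause of Frobenius G;
-- transitivity comes from N and non-regularity from 2-transitivity.
corollary5p7 : ∀ (n : ℕ) → 3 ≤ n → (G N : PermGroup n) →
    TwoTransitive G → Normal N G → Regular N →
    (Frobenius G ⇔ DisjointUnionOfCompleteGraphs G (DerangementAdj G))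
corollary5p7 (suc (suc (suc k))) _ G N twoTrans (N≤G , _) regN =
  mk⇔ (λ frobenius → fixesAtMostOnePoint⇒cliques zero (proj₂ (proj₂ frobenius)))
      (λ cliques →
        transitive-≤ N G N≤G (proj₁ regN) ,
        (λ regG → twoTransitive⇒¬semiregular G twoTrans (proj₂ regG)) ,
        cliques⇒fixesAtMostOnePoint cliques)
  where open RegularSubgroup G N N≤G regN
corollary5p7 zero () G N twoTrans nor regN
corollary5p7 (suc zero) (s≤s ()) G N twoTrans nor regN
corollary5p7 (suc (suc zero)) (s≤s (s≤s ())) G N twoTrans nor regN
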